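{- Let $M\subseteq\mathbb{Z}^2$, $n\ge1$, $\mathbf{x}\in\mathbb{Z}^2$ and $\mathbf{v}\in\mathbb{Z}^2\setminus\{\mathbf{0}\}$ with $\|\mathbf{v}\|<n$. Suppose $M$ is $\mathbf{v}$-periodic inside $\mathcal{B}(\mathbf{x},n)$ and is not $\mathbf{w}$-periodic inside $\mathcal{B}(\mathbf{x},n)$ for any non-zero $\mathbf{w}\in\mathbb{Z}^2$ with $\|\mathbf{w}\|<\|\mathbf{v}\|$. Then the $\|\mathbf{v}\|^2$ blocks $M_{\mathbf{x}-n\mathbf{1}-\mathbf{z},\,2n+\|\mathbf{v}\|}$, $\mathbf{z}\in[\![0,\|\mathbf{v}\|-1]\!]^2$, are pairwise distinct.
   Context: Norm: $\|\mathbf{x}\|=\max_i|\mathbf{x}_i|$; $\mathbf{1}=(1,1)$. $\mathcal{B}(\mathbf{x},n)=\{\mathbf{y}\in\mathbb{Z}^2\mid\|\mathbf{x}-\mathbf{y}\|<n\}$. For non-zero $\mathbf{v}$ and $X\subseteq\mathbb{Z}^2$, $M$ is $\mathbf{v}$-periodic inside $X$ if for all $\mathbf{m}$ with $\mathbf{m},\mathbf{m}+\mathbf{v}\in X$: $\mathbf{m}\in M\iff\mathbf{m}+\mathbf{v}\in M$. The block $M_{\mathbf{y},k}$ is the map $[\![0,k-1]\!]^2\to\{0,1\}$, $\mathbf{u}\mapsto\mathbf{1}_M(\mathbf{y}+\mathbf{u})$; blocks are equal iff these maps coincide. -}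

module Defs where

open import Level using (0ℓ)
open import Data.Nat as ℕ using (ℕ; _⊔_)
open import Data.Integer as ℤ using (ℤ; +_; ∣_∣)
open import Data.Product using (_×_; _,_; proj₁; proj₂)
open import Relation.Unary using (Pred; _∈_)
open import Function.Bundles using (_⇔_)

ℤ² : Set
ℤ² = ℤ × ℤ

_+²_ : ℤ² → ℤ² → ℤ²
(a , b) +² (c , d) = (a ℤ.+ c , b ℤ.+ d)

_-²_ : ℤ² → ℤ² → ℤ²
(a , b) -² (c , d) = (a ℤ.- c , b ℤ.- d)

_·²_ : ℤ → ℤ² → ℤ²
k ·² (a , b) = (k ℤ.* a , k ℤ.* b)

𝟎 : ℤ²
𝟎 = (+ 0 , + 0)

𝟏 : ℤ²
𝟏 = (+ 1 , + 1)

‖_‖ : ℤ² → ℕ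
‖ (a , b) ‖ = ∣ a ∣ ⊔ ∣ b ∣

Ball : ℤ² → ℕ → Pred ℤ² 0ℓ
Ball x n y = ‖ x -² y ‖ ℕ.< n

PeriodicInside : Pred ℤ² 0ℓ → ℤ² → Pred ℤ² 0ℓ → Set
PeriodicInside M v X =
  ∀ m → m ∈ X → (m +² v) ∈ X → (m ∈ M ⇔ (m +² v) ∈ M)

Box : ℕ → Pred ℤ² 0ℓ
Box k (a , b) = (+ 0 ℤ.≤ a × a ℤ.< + k) × (+ 0 ℤ.≤ b × b ℤ.< + k)

-- Equality of blocks M_{y,k} and M_{y',k}: the maps u ↦ 1_M(y+u) and
-- u ↦ 1_M(y'+u) on [[0,k-1]]² coincide, i.e. membership agrees.
BlockEq : Pred ℤ² 0ℓ → ℕ → ℤ² → ℤ² → Set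
BlockEq M k y y' = ∀ u → u ∈ Box k → ((y +² u) ∈ M ⇔ (y' +² u) ∈ M)

module Submission where

open import Defs
open import Level using (0ℓ)
open import Data.Nat as ℕ using (ℕ)
open import Data.Integer as ℤ using (+_)
open import Relation.Unary using (Pred; _∈_)
open import Relation.Binary.PropositionalEquality using (_≡_)
open import Relation.Nullary using (¬_)

open import Data.Integer using (ℤ; -[1+_]; ∣_∣; +≤+; +<+)
import Data.Integer.Properties as ℤP
import Data.Nat.Properties as ℕP
open import Data.Integer.Tactic.RingSolver using (solve-∀)
open import Data.Product using (_×_; _,_; proj₁; proj₂)
open import Relation.Binary.PropositionalEquality using (refl; sym; trans; cong; cong₂; subst)
open import Function.Bundles using (_⇔_)
import Function.Properties.Equivalence as ⇔

-- Write y = x - n𝟏. If the blocks at y - z and y - z' agree, then comparing them at offset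
-- m - y + z' shows m ∈ M ⇔ m + (z' - z) ∈ M, and for m ∈ B(x,n) that offset lies in the
-- block. So M is (z' - z)-periodic on the ball, and z ≠ z' in [0,‖v‖)² makes z' - z a
-- non-zero period shorter than v, contradicting minimality.

Range : ℕ → Pred ℤ 0ℓ
Range k i = + 0 ℤ.≤ i × i ℤ.< + k

Range-∣-∣< : ∀ {p i j} → i ∈ Range p → j ∈ Range p → ∣ j ℤ.- i ∣ ℕ.< p
Range-∣-∣< {p} {+ i} {+ j} (_ , +<+ i<p) (_ , +<+ j<p) =
  subst (λ t → ∣ t ∣ ℕ.< p) (sym (ℤP.[+m]-[+n]≡m⊖n j i))
    (ℕP.≤-<-trans (ℤP.∣m⊝n∣≤m⊔n j i) (ℕP.⊔-pres-<m j<p i<p))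

Range-shift : ∀ {n p i c} → ∣ i ∣ ℕ.< n → c ∈ Range p →
  (+ n ℤ.- i) ℤ.+ c ∈ Range (2 ℕ.* n ℕ.+ p)
Range-shift {n} {p} {+ k} {+ c} k<n (_ , +<+ c<p) =
  subst (λ t → t ℤ.+ + c ∈ Range (2 ℕ.* n ℕ.+ p))
    (sym (trans (ℤP.[+m]-[+n]≡m⊖n n k) (ℤP.⊖-≥ (ℕP.<⇒≤ k<n))))
    (+≤+ ℕ.z≤n , +<+ (ℕP.<-≤-trans (ℕP.+-mono-≤-< (ℕP.m∸n≤m n k) c<p)
       (ℕP.+-monoˡ-≤ p (ℕP.m≤m+n n (n ℕ.+ 0)))))
Range-shift {n} {p} { -[1+ k ]} {+ c} k<n (_ , +<+ c<p) =
  +≤+ ℕ.z≤n , +<+ (subst (λ t → n ℕ.+ ℕ.suc k ℕ.+ c ℕ.< t ℕ.+ p)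
     (cong (n ℕ.+_) (sym (ℕP.+-identityʳ n)))
     (ℕP.+-mono-≤-< (ℕP.+-monoʳ-≤ n (ℕP.<⇒≤ k<n)) c<p))

-²≡𝟎⇒≡ : ∀ {a b} → a -² b ≡ 𝟎 → a ≡ b
-²≡𝟎⇒≡ {a₁ , a₂} {b₁ , b₂} eq =
  cong₂ _,_ (ℤP.i-j≡0⇒i≡j a₁ b₁ (cong proj₁ eq)) (ℤP.i-j≡0⇒i≡j a₂ b₂ (cong proj₂ eq))

Box-‖-‖< : ∀ {p z z'} → z ∈ Box p → z' ∈ Box p → ‖ z' -² z ‖ ℕ.< p
Box-‖-‖< (r₁ , r₂) (r₁' , r₂') = ℕP.⊔-pres-<m (Range-∣-∣< r₁ r₁') (Range-∣-∣< r₂ r₂')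

Ball⇒Box : ∀ {n p x m z} → m ∈ Ball x n → z ∈ Box p →
  m -² ((x -² ((+ n) ·² 𝟏)) -² z) ∈ Box (2 ℕ.* n ℕ.+ p)
Ball⇒Box {n} {p} {x₁ , x₂} {m₁ , m₂} {z₁ , z₂} m∈B (r₁ , r₂) =
    subst (_∈ Range (2 ℕ.* n ℕ.+ p)) (corner-offset (+ n) x₁ m₁ z₁)
      (Range-shift {i = x₁ ℤ.- m₁} (ℕP.m⊔n<o⇒m<o ∣ x₁ ℤ.- m₁ ∣ ∣ x₂ ℤ.- m₂ ∣ m∈B) r₁)
  , subst (_∈ Range (2 ℕ.* n ℕ.+ p)) (corner-offset (+ n) x₂ m₂ z₂)
      (Range-shift {i = x₂ ℤ.- m₂} (ℕP.m⊔n<o⇒n<o ∣ x₁ ℤ.- m₁ ∣ ∣ x₂ ℤ.- m₂ ∣ m∈B) r₂)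
  where
  corner-offset : ∀ N x m z → (N ℤ.- (x ℤ.- m)) ℤ.+ z ≡ m ℤ.- ((x ℤ.- N ℤ.* + 1) ℤ.- z)
  corner-offset = solve-∀

BlockEq⇒PeriodicInside : ∀ {M k a b} {X : Pred ℤ² 0ℓ} →
  (∀ m → m ∈ X → m -² b ∈ Box k) → BlockEq M k a b → PeriodicInside M (a -² b) X
BlockEq⇒PeriodicInside {M} {a = a} {b} X⊆window a≈b m m∈X _ =
  ⇔.sym (subst₂-⇔ (shifted a b m) (unshifted b m) (a≈b (m -² b) (X⊆window m m∈X)))
  where
  subst₂-⇔ : ∀ {p q p' q'} → p ≡ p' → q ≡ q' → (p ∈ M ⇔ q ∈ M) → (p' ∈ M ⇔ q' ∈ M)
  subst₂-⇔ refl refl e = e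
  shifted : ∀ a b m → a +² (m -² b) ≡ m +² (a -² b)
  shifted (a₁ , a₂) (b₁ , b₂) (m₁ , m₂) = cong₂ _,_ (ring a₁ b₁ m₁) (ring a₂ b₂ m₂)
    where
    ring : ∀ a b m → a ℤ.+ (m ℤ.- b) ≡ m ℤ.+ (a ℤ.- b)
    ring = solve-∀
  unshifted : ∀ b m → b +² (m -² b) ≡ m
  unshifted (b₁ , b₂) (m₁ , m₂) = cong₂ _,_ (ring b₁ m₁) (ring b₂ m₂)
    where
    ring : ∀ b m → b ℤ.+ (m ℤ.- b) ≡ m
    ring = solve-∀

corner-difference : ∀ y z z' → (y -² z) -² (y -² z') ≡ z' -² z
corner-difference (y₁ , y₂) (z₁ , z₂) (z₁' , z₂') = cong₂ _,_ (ring y₁ z₁ z₁') (ring y₂ z₂ z₂')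
  where
  ring : ∀ y z z' → (y ℤ.- z) ℤ.- (y ℤ.- z') ≡ z' ℤ.- z
  ring = solve-∀

lemma5p2 : (M : Pred ℤ² 0ℓ) (n : ℕ) (x v : ℤ²) →
    1 ℕ.≤ n → ¬ (v ≡ 𝟎) → ‖ v ‖ ℕ.< n →
    PeriodicInside M v (Ball x n) →
    (∀ w → ¬ (w ≡ 𝟎) → ‖ w ‖ ℕ.< ‖ v ‖ → ¬ PeriodicInside M w (Ball x n)) →
    ∀ z z' → z ∈ Box ‖ v ‖ → z' ∈ Box ‖ v ‖ → ¬ (z ≡ z') →
    ¬ BlockEq M (2 ℕ.* n ℕ.+ ‖ v ‖)
    ((x -² ((+ n) ·² 𝟏)) -² z) ((x -² ((+ n) ·² 𝟏)) -² z')
lemma5p2 M n x v _ _ _ _ minimal z z' z∈B z'∈B z≢z' blocks≈ =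
  minimal (z' -² z) (λ w≡𝟎 → z≢z' (sym (-²≡𝟎⇒≡ w≡𝟎))) (Box-‖-‖< z∈B z'∈B)
    (subst (λ w → PeriodicInside M w (Ball x n)) (corner-difference corner z z')
      (BlockEq⇒PeriodicInside {a = corner -² z} {corner -² z'}
        (λ m m∈B → Ball⇒Box {x = x} {m} m∈B z'∈B) blocks≈))
  where
  corner : ℤ²
  corner = x -² ((+ n) ·² 𝟏)
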